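{- The scheme $\langle[G\cup H]\rangle\varphi\to\langle[G]\rangle\langle[H]\rangle\varphi$ is not valid: there exist a finite set of agents $A$, subsets $G,H\subseteq A$ and a formula $\varphi\in\mathcal{L}_{CoRGAL}$ such that $\langle[G\cup H]\rangle\varphi\to\langle[G]\rangle\langle[H]\rangle\varphi$ is false at some pointed epistemic model.
   Context: Given a finite set $A$ of agents and a countable set $P$ of propositional variables, the language $\mathcal{L}_{CoRGAL}$ is given by $\varphi ::= p \mid \neg\varphi \mid (\varphi\wedge\varphi) \mid K_a\varphi \mid [\varphi]\varphi \mid [G,\varphi]\varphi \mid [\langle G\rangle]\varphi$ with $p\in P$, $a\in A$, $G\subseteq A$; $\langle\varphi\rangle\psi:=\neg[\varphi]\neg\psi$, $\langle[G]\rangle\varphi:=\neg[\langle G\rangle]\neg\varphi$. $\mathcal{L}_{EL}$ is the fragment built only from $p,\neg,\wedge,K_a$. For $G\subseteq A$, $\mathcal{L}_{EL}^G$ is the set of formulas $\bigwedge_{i\in G}K_i\varphi_i$ with each $\varphi_i\in\mathcal{L}_{EL}$; $\psi_G$ denotes an element of $\mathcal{L}_{EL}^G$, $\chi_{A\setminus G}$ one of $\mathcal{L}_{EL}^{A\setminus G}$. An epistemic model is $M=(W,\sim,V)$ with $W\neq\emptyset$, each $\sim_a$ an equivalence relation, $V:P\to\mathcal{P}(W)$. $M^\varphi$ is the restriction of $M$ to the states where $\varphi$ holds. Semantics: $p,\neg,\wedge$ as usual; $K_a\varphi$ true at $w$ iff $\varphi$ true at all $v\sim_a w$; $(M,w)\models[\varphi]\psi$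 iff $(M,w)\models\varphi$ implies $(M^\varphi,w)\models\psi$; $(M,w)\models[G,\chi]\varphi$ iff $(M,w)\models\chi$ and for all $\psi_G$, $(M,w)\models[\psi_G\wedge\chi]\varphi$; $(M,w)\models[\langle G\rangle]\varphi$ iff for all $\psi_G$ there is $\chi_{A\setminus G}$ with $(M,w)\models\psi_G\to\langle\psi_G\wedge\chi_{A\setminus G}\rangle\varphi$. Equivalently, $(M,w)\models\langle[G]\rangle\varphi$ iff there is $\psi_G$ such that for all $\chi_{A\setminus G}$, $(M,w)\models\psi_G\wedge[\psi_G\wedge\chi_{A\setminus G}]\varphi$. Valid means true at every pointed model. -}

module Defs where

open import Data.Nat using (ℕ)
open import Data.Fin using (Fin)
open import Data.Fin.Subset using (Subset; _∈_; ∁; _∪_)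
open import Data.Product using (Σ; _×_; _,_; proj₁; ∃)
open import Relation.Nullary using (¬_)
open import Relation.Binary using (IsEquivalence)
open import Level using (0ℓ)

data EL (n : ℕ) : Set where
  var  : ℕ → EL n
  neg  : EL n → EL n
  conj : EL n → EL n → EL n
  K    : Fin n → EL n → EL n

data Form (n : ℕ) : Set where
  var   : ℕ → Form n
  neg   : Form n → Form n
  conj  : Form n → Form n → Form n
  K     : Fin n → Form n → Form n
  ann   : Form n → Form n → Form n
  coal  : Subset n → Form n → Form n → Form n
  cor   : Subset n → Form n → Form n

imp : ∀ {n} → Form n → Form n → Form n
imp φ ψ = neg (conj φ (neg ψ))

dcor : ∀ {n} → Subset n → Form n → Form n
dcor G φ = neg (cor G (neg φ))

record Model (n : ℕ) : Set₁ where
  field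
    W     : Set
    R     : Fin n → W → W → Set
    R-eq  : (a : Fin n) → IsEquivalence (R a)
    V     : ℕ → W → Set

restrict : ∀ {n} (M : Model n) → (Model.W M → Set) → Model n
restrict M P = record
  { W    = Σ (Model.W M) P
  ; R    = λ a x y → Model.R M a (proj₁ x) (proj₁ y)
  ; R-eq = λ a → record
      { refl  = IsEquivalence.refl (Model.R-eq M a)
      ; sym   = IsEquivalence.sym (Model.R-eq M a)
      ; trans = IsEquivalence.trans (Model.R-eq M a) }
  ; V    = λ p x → Model.V M p (proj₁ x)
  }

satEL : ∀ {n} (M : Model n) → Model.W M → EL n → Set
satEL M w (var p)    = Model.V M p w
satEL M w (neg φ)    = ¬ satEL M w φ
satEL M w (conj φ ψ) = satEL M w φ × satEL M w ψ
satEL M w (K a φ)    = ∀ v → Model.R M a w v → satEL M v φ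

-- An element ψ_G = ⋀_{i∈G} K_i φ_i of L_EL^G is given by the family φ : Fin n → EL n
-- (only the components with i ∈ G matter).  Its truth:
satGrp : ∀ {n} (M : Model n) → Model.W M → Subset n → (Fin n → EL n) → Set
satGrp M w G φ = ∀ i → i ∈ G → satEL M w (K i (φ i))

sat : ∀ {n} (M : Model n) → Model.W M → Form n → Set
sat M w (var p)    = Model.V M p w
sat M w (neg φ)    = ¬ sat M w φ
sat M w (conj φ ψ) = sat M w φ × sat M w ψ
sat M w (K a φ)    = ∀ v → Model.R M a w v → sat M v φ
sat M w (ann φ ψ)  = (h : sat M w φ) → sat (restrict M (λ v → sat M v φ)) (w , h) ψ
sat M w (coal G χ φ) =
  sat M w χ ×
  ((ψ : Fin _ → EL _) →
    (h : satGrp M w G ψ × sat M w χ) →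
    sat (restrict M (λ v → satGrp M v G ψ × sat M v χ)) (w , h) φ)
-- (M,w) ⊨ [⟨G⟩]φ  iff  for all ψ_G there is χ_{A∖G} with
--   (M,w) ⊨ ψ_G → ⟨ψ_G ∧ χ_{A∖G}⟩φ
sat M w (cor G φ) =
  (ψ : Fin _ → EL _) → ∃ λ (χ : Fin _ → EL _) →
    satGrp M w G ψ →
    ¬ ((h : satGrp M w G ψ × satGrp M w (∁ G) χ) →
        ¬ sat (restrict M (λ v → satGrp M v G ψ × satGrp M v (∁ G) χ)) (w , h) φ)

module Submission where

-- Take two agents: a, who cannot distinguish any states, and b, who can
-- distinguish all of them, over the states {true, false} with p true only at
-- true.  Let G = ∅, H = A (so G ∪ H = A) and φ = ¬K_a p.
--
--  * ⟨[A]⟩φ holds at true: the grand coalition announces only tautologies,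
--    the (empty) opposing coalition has no say, and in the unchanged model a
--    still considers the ¬p-state false possible.
--  * ⟨[∅]⟩⟨[A]⟩φ fails at true: whatever the empty coalition does, the
--    opponents A may let b announce K_b p, which deletes the state false; in
--    the remaining model a knows p, and no later announcement can undo that.

open import Defs
open import Data.Nat using (ℕ; zero; suc)
open import Data.Fin using (Fin) renaming (zero to a₀; suc to fsuc)
open import Data.Fin.Subset using (Subset; _∪_; ∁; ⊥; ⊤)
open import Data.Fin.Subset.Properties using (∉⊥; ∈⊤)
open import Data.Product using (Σ; _,_; _×_; proj₁; proj₂)
open import Data.Bool using (Bool; true; false)
open import Data.Unit using (tt) renaming (⊤ to Unit)
open import Data.Empty using () renaming (⊥ to Empty)
open import Relation.Nullary using (¬_; contradiction)
open import Relation.Binary using (IsEquivalence)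
open import Relation.Binary.PropositionalEquality using (_≡_; refl; isEquivalence)

announce : ∀ {n} (M : Model n) (G : Subset n) (ψ χ : Fin n → EL n) → Model n
announce M G ψ χ = restrict M (λ v → satGrp M v G ψ × satGrp M v (∁ G) χ)

dcor-intro : ∀ {n} (M : Model n) (w : Model.W M) (G : Subset n) (φ : Form n)
  (ψ : Fin n → EL n) → satGrp M w G ψ →
  ((χ : Fin n → EL n) (h : satGrp M w G ψ × satGrp M w (∁ G) χ) →
     sat (announce M G ψ χ) (w , h) φ) →
  sat M w (dcor G φ)
dcor-intro M w G φ ψ ψ-true φ-after notDcor with notDcor ψ
... | χ , refuted = refuted ψ-true (λ h notφ → notφ (φ-after χ h))

dcor-refute : ∀ {n} (M : Model n) (w : Model.W M) (G : Subset n) (φ : Form n)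
  (reply : (Fin n → EL n) → Fin n → EL n) →
  ((ψ : Fin n → EL n) (ψ-true : satGrp M w G ψ) →
     Σ (satGrp M w (∁ G) (reply ψ)) λ χ-true →
       ¬ sat (announce M G ψ (reply ψ)) (w , ψ-true , χ-true) φ) →
  ¬ sat M w (dcor G φ)
dcor-refute M w G φ reply wins d =
  d (λ ψ → reply ψ , λ ψ-true answer →
       let (χ-true , notφ) = wins ψ ψ-true in answer (ψ-true , χ-true) notφ)

taut : ∀ {n} → EL n
taut = neg (conj (var 0) (neg (var 0)))

taut-true : ∀ {n} (M : Model n) (w : Model.W M) → satEL M w taut
taut-true M w (p , ¬p) = ¬p p

tautologies-true : ∀ {n} (M : Model n) (w : Model.W M) (G : Subset n) →
  satGrp M w G (λ _ → taut)
tautologies-true M w G i _ v _ = taut-true M v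

empty-coalition : ∀ {n} (M : Model n) (w : Model.W M) (χ : Fin n → EL n) →
  satGrp M w ⊥ χ
empty-coalition M w χ i i∈⊥ = contradiction i∈⊥ ∉⊥

veridical : ∀ {n} (M : Model n) (w : Model.W M) (a : Fin n) (φ : EL n) →
  satEL M w (K a φ) → satEL M w φ
veridical M w a φ know = know w (IsEquivalence.refl (Model.R-eq M a))

b : Fin 2
b = fsuc a₀

access : Fin 2 → Bool → Bool → Set
access a₀       _ _ = Unit
access (fsuc _) u v = u ≡ v

access-equivalence : (a : Fin 2) → IsEquivalence (access a)
access-equivalence a₀ = record { refl = tt ; sym = λ _ → tt ; trans = λ _ _ → tt }
access-equivalence (fsuc _) = isEquivalence

valuation : ℕ → Bool → Set
valuation zero    u = u ≡ true
valuation (suc _) _ = Empty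

M : Model 2
M = record { W = Bool ; R = access ; R-eq = access-equivalence ; V = valuation }

φ : Form 2
φ = neg (K a₀ (var 0))

-- ⟨[A]⟩φ holds at true: after the grand coalition announces tautologies the
-- state false survives and a₀ still considers it.
grand-coalition-wins : sat M true (dcor ⊤ φ)
grand-coalition-wins =
  dcor-intro M true ⊤ φ (λ _ → taut) (tautologies-true M true ⊤)
    (λ χ _ knows-p → false≢true (knows-p (false , survives χ) tt))
  where
  survives : (χ : Fin 2 → EL 2) →
    satGrp M false ⊤ (λ _ → taut) × satGrp M false ⊥ χ
  survives χ = tautologies-true M false ⊤ , empty-coalition M false χ
  false≢true : ¬ false ≡ true
  false≢true ()

-- The opponents' reply "b knows p" (a₀ contributes a tautology); true at true.
b-knows-p : Fin 2 → EL 2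
b-knows-p a₀       = taut
b-knows-p (fsuc _) = var 0

b-knows-p-true : satGrp M true ⊤ b-knows-p
b-knows-p-true a₀              _ v _    = taut-true M v
b-knows-p-true (fsuc a₀)       _ _ refl = refl
b-knows-p-true (fsuc (fsuc ())) _

-- ⟨[∅]⟩⟨[A]⟩φ fails at true: the reply "b knows p" leaves only p-states, so
-- a₀ knows p in the announced model and in every further restriction of it.
empty-coalition-loses : ¬ sat M true (dcor ⊥ (dcor ⊤ φ))
empty-coalition-loses =
  dcor-refute M true ⊥ (dcor ⊤ φ) (λ _ → b-knows-p) λ ψ ψ-true →
    b-knows-p-true , a₀-knows-p-forever ψ ψ-true
  where
  a₀-knows-p-forever : (ψ : Fin 2 → EL 2) (ψ-true : satGrp M true ⊥ ψ) →
    ¬ sat (announce M ⊥ ψ b-knows-p) (true , ψ-true , b-knows-p-true) (dcor ⊤ φ)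
  a₀-knows-p-forever ψ ψ-true =
    dcor-refute N (true , ψ-true , b-knows-p-true) ⊤ φ (λ _ → b-knows-p)
      λ ψ′ ψ′-true →
        empty-coalition N (true , ψ-true , b-knows-p-true) b-knows-p ,
        λ not-knows → not-knows λ v _ →
          veridical M (proj₁ (proj₁ v)) b (var 0) (proj₂ (proj₂ (proj₁ v)) b ∈⊤)
    where
    N : Model 2
    N = announce M ⊥ ψ b-knows-p

proposition7 : Σ ℕ λ n → Σ (Subset n) λ G → Σ (Subset n) λ H → Σ (Form n) λ φ →
                 Σ (Model n) λ M → Σ (Model.W M) λ w →
                   ¬ sat M w (imp (dcor (G ∪ H) φ) (dcor G (dcor H φ)))
proposition7 =
  2 , ⊥ , ⊤ , φ , M , true ,
  λ implication → implication (grand-coalition-wins , empty-coalition-loses)
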